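{- Let $\Phi$ be a finite crystallographic root system and $R$ a $\Phi$-poset. Then $R$ is the only $\Phi$-poset containing $R$ (i.e. $\mathrm{Ext}(R)=\{R\}$) if and only if $\{\alpha,-\alpha\}\cap R\neq\varnothing$ for every $\alpha\in\Phi$.
   Context: Let $V$ be a real Euclidean space with scalar product $\langle\cdot,\cdot\rangle$. For $\alpha\neq0$ let $\alpha^\vee=2\alpha/\langle\alpha,\alpha\rangle$ and $s_\alpha(v)=v-\langle\alpha^\vee,v\rangle\alpha$. A finite root system is a finite set $\Phi\subset V\setminus\{0\}$ with $\Phi\cap\mathbb{R}\alpha=\{\alpha,-\alpha\}$ and $s_\alpha\Phi=\Phi$ for all $\alpha\in\Phi$; it is crystallographic if $\langle\alpha^\vee,\beta\rangle\in\mathbb{Z}$ for all $\alpha,\beta\in\Phi$. A subset $R\subseteq\Phi$ is antisymmetric if $R\cap-R=\varnothing$, and closed if $\alpha,\beta\in R$, $m,n\in\mathbb{N}$ and $m\alpha+n\beta\in\Phi$ imply $m\alpha+n\beta\in R$. A $\Phi$-poset is an antisymmetric closed subset of $\Phi$. For a $\Phi$-poset $R$, $\mathrm{Ext}(R)$ denotes the set of $\Phi$-posets $S$ with $R\subseteq S$. -}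

module Defs where

open import Level using (0ℓ)
open import Data.Nat using (ℕ; zero; suc)
open import Data.Integer using (ℤ; +_; -[1+_])
open import Data.Fin using (Fin)
open import Data.Fin.Subset using (Subset; _∈_; _⊆_)
open import Data.Vec using (Vec; map; zipWith; foldr; replicate)
open import Data.Product using (Σ; ∃; ∃-syntax; _×_; _,_)
open import Data.Sum using (_⊎_)
open import Relation.Binary.PropositionalEquality using (_≡_; _≢_)
open import Relation.Binary.Core using (Rel)
open import Relation.Binary.Structures using (IsTotalOrder)
open import Algebra.Structures using (IsCommutativeRing)
open import Relation.Nullary using (¬_)

-- The real numbers, axiomatised as a complete ordered field
-- (ℝ is, up to unique isomorphism, the only such structure).
-- The inverse is total with the junk value 0⁻¹ = 0 (only ever used at
-- nonzero arguments below).

record RealField : Set₁ where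
  infixl 6 _+_
  infixl 7 _*_
  infix  4 _≤_
  field
    Carrier : Set
    _+_ _*_ : Carrier → Carrier → Carrier
    -_      : Carrier → Carrier
    0# 1#   : Carrier
    isCommutativeRing : IsCommutativeRing _≡_ _+_ _*_ -_ 0# 1#
    _⁻¹     : Carrier → Carrier
    ⁻¹-inverse : ∀ x → x ≢ 0# → x * (x ⁻¹) ≡ 1#
    ⁻¹-zero : 0# ⁻¹ ≡ 0#
    0≢1     : 0# ≢ 1#
    _≤_     : Rel Carrier 0ℓ
    isTotalOrder : IsTotalOrder _≡_ _≤_
    +-mono-≤ : ∀ {x y} z → x ≤ y → x + z ≤ y + z
    *-nonneg : ∀ {x y} → 0# ≤ x → 0# ≤ y → 0# ≤ x * y
    complete : (P : Carrier → Set) → Σ Carrier P →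
               (∃[ b ] (∀ x → P x → x ≤ b)) →
               ∃[ s ] ((∀ x → P x → x ≤ s) ×
                       (∀ b → (∀ x → P x → x ≤ b) → s ≤ b))

module _ (ℝ : RealField) where
  open RealField ℝ

  fromℕ : ℕ → Carrier
  fromℕ zero    = 0#
  fromℕ (suc k) = 1# + fromℕ k

  fromℤ : ℤ → Carrier
  fromℤ (+ k)      = fromℕ k
  fromℤ -[1+ k ]   = - (1# + fromℕ k)

  -- The Euclidean space V = ℝ^d with its standard scalar product
  -- (every Euclidean space is isometric to some ℝ^d).
  V : ℕ → Set
  V d = Vec Carrier d

  module _ {d : ℕ} where
    0ᵥ : V d
    0ᵥ = replicate d 0#

    _+ᵥ_ : V d → V d → V d
    _+ᵥ_ = zipWith _+_

    _·_ : Carrier → V d → V d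
    c · v = map (c *_) v

    -ᵥ_ : V d → V d
    -ᵥ v = map -_ v

    _-ᵥ_ : V d → V d → V d
    u -ᵥ v = u +ᵥ (-ᵥ v)

    ⟨_,_⟩ : V d → V d → Carrier
    ⟨ u , v ⟩ = foldr _ _+_ 0# (zipWith _*_ u v)

    coroot : V d → V d
    coroot α = ((1# + 1#) * (⟨ α , α ⟩ ⁻¹)) · α

    reflect : V d → V d → V d
    reflect α v = v -ᵥ (⟨ coroot α , v ⟩ · α)

  -- A finite root system in ℝ^d, given as an injective enumeration
  -- Φ = {root i | i : Fin n}.
  record RootSystem (d n : ℕ) : Set where
    field
      root : Fin n → V d
    InΦ : V d → Set
    InΦ v = ∃[ j ] root j ≡ v
    field
      root-injective : ∀ i j → root i ≡ root j → i ≡ j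
      nonzero  : ∀ i → root i ≢ 0ᵥ
      line⊆    : ∀ i v → InΦ v → (∃[ c ] v ≡ c · root i) →
                 (v ≡ root i) ⊎ (v ≡ -ᵥ root i)
      line⊇    : ∀ i v → (v ≡ root i) ⊎ (v ≡ -ᵥ root i) →
                 InΦ v × (∃[ c ] v ≡ c · root i)
      reflect⊆ : ∀ i j → InΦ (reflect (root i) (root j))
      reflect⊇ : ∀ i j → ∃[ k ] reflect (root i) (root k) ≡ root j

  module _ {d n : ℕ} (Φ : RootSystem d n) where
    open RootSystem Φ

    Crystallographic : Set
    Crystallographic = ∀ i j → ∃[ z ] ⟨ coroot (root i) , root j ⟩ ≡ fromℤ z

    -- subsets of Φ are subsets of the index set Fin n
    Antisymmetric : Subset n → Set
    Antisymmetric R = ∀ i j → i ∈ R → j ∈ R → root j ≢ -ᵥ root i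

    Closed : Subset n → Set
    Closed R = ∀ i j k (m l : ℕ) → i ∈ R → j ∈ R →
               ((fromℕ m · root i) +ᵥ (fromℕ l · root j)) ≡ root k → k ∈ R

    IsΦPoset : Subset n → Set
    IsΦPoset R = Antisymmetric R × Closed R

    Ext : Subset n → Subset n → Set
    Ext R S = IsΦPoset S × R ⊆ S

-- (⇐) An extension S ⊇ R containing a root β ∉ R would also contain −β ∈ R, against antisymmetry.
-- (⇒) Suppose neither α nor −α lies in R. The roots that are positive integer sums of roots from
-- R ∪ {α} form a closed set containing R and α, so by maximality it is not antisymmetric: some
-- nonempty positive sum from R ∪ {α} vanishes, and likewise for −α. A Φ-poset carries no vanishing
-- positive sum (two summands with negative pairing add up to a root, shortening the sum), so both
-- sums use the adjoined root: R-sums equal −kα and −k′(−α) with k, k′ > 0. Then k′ times the first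
-- plus k times the second is a vanishing positive sum from R, a contradiction.
module Submission where

open import Algebra.Bundles using (CommutativeRing)
import Algebra.Properties.AbelianGroup as AbelianGroupProperties
import Algebra.Properties.CommutativeSemigroup as CommutativeSemigroupProperties
import Algebra.Properties.Ring as RingProperties
import Algebra.Solver.Ring
open import Algebra.Solver.Ring.AlmostCommutativeRing
  using (fromCommutativeRing; _-Raw-AlmostCommutative⟶_)
open import Data.Empty using (⊥; ⊥-elim)
open import Data.Fin using (Fin; zero; suc)
open import Data.Fin.Subset using (Subset; _∈_; _∉_; _⊆_)
open import Data.Fin.Subset.Properties using (_∈?_; ⊆-antisym)
open import Data.Integer as ℤ using (ℤ; -[1+_])
import Data.Integer.Properties as ℤ
open import Data.List using (List; []; _∷_; _++_; length)
open import Data.List.Membership.Propositional using (find) renaming (_∈_ to _∈ₗ_)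
open import Data.List.Membership.Propositional.Properties using (∈-∃++)
open import Data.List.Properties using (length-++)
open import Data.List.Relation.Unary.All using (All; []; _∷_)
open import Data.List.Relation.Unary.All.Properties using (¬All⇒Any¬)
open import Data.Maybe using (just; nothing; maybe; map)
open import Data.Nat as ℕ using (ℕ; zero; suc)
import Data.Nat.Properties as ℕ
open import Data.Product using (Σ; ∃; ∃₂; ∃-syntax; _×_; _,_; proj₁; proj₂)
open import Data.Sign as Sign using (Sign)
open import Data.Sum using (_⊎_; inj₁; inj₂)
open import Data.Vec using ([]; _∷_; tabulate)
open import Data.Vec.Properties
  using ( zipWith-assoc; zipWith-comm; zipWith-identityˡ; zipWith-identityʳ; zipWith-inverseˡ
        ; zipWith-inverseʳ; ∷-injectiveˡ; ∷-injectiveʳ; lookup∘tabulate; lookup⇒[]=; []=⇒lookup)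
open import Function using (_∘_)
open import Function.Bundles using (_⇔_; mk⇔)
open import Level using (0ℓ)
open import Relation.Binary.PropositionalEquality
open import Relation.Binary.Structures using (IsTotalOrder)
open import Relation.Nullary using (¬_)
open import Relation.Nullary.Decidable
  using (Dec; yes; no; does; dec⇒maybe; dec-true; ¬¬-excluded-middle)
open import Relation.Unary using (Decidable)

open import Defs hiding (0ᵥ; _+ᵥ_; _·_; -ᵥ_; _-ᵥ_; ⟨_,_⟩; coroot; reflect; fromℕ; fromℤ)

module Notation (ℝ : RealField) where

  open RealField ℝ

  fromℕ : ℕ → Carrier
  fromℕ = Defs.fromℕ ℝ

  fromℤ : ℤ → Carrier
  fromℤ = Defs.fromℤ ℝ

  module _ {d : ℕ} where

    infixr 8 -ᵥ_
    infixr 7 _·_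
    infixl 6 _+ᵥ_ _-ᵥ_

    0ᵥ : V ℝ d
    0ᵥ = Defs.0ᵥ ℝ

    _+ᵥ_ _-ᵥ_ : V ℝ d → V ℝ d → V ℝ d
    _+ᵥ_ = Defs._+ᵥ_ ℝ
    _-ᵥ_ = Defs._-ᵥ_ ℝ

    -ᵥ_ : V ℝ d → V ℝ d
    -ᵥ_ = Defs.-ᵥ_ ℝ

    _·_ : Carrier → V ℝ d → V ℝ d
    _·_ = Defs._·_ ℝ

    ⟨_,_⟩ : V ℝ d → V ℝ d → Carrier
    ⟨_,_⟩ = Defs.⟨_,_⟩ ℝ

    coroot : V ℝ d → V ℝ d
    coroot = Defs.coroot ℝ

    reflect : V ℝ d → V ℝ d → V ℝ d
    reflect = Defs.reflect ℝ

module RealFieldProperties (ℝ : RealField) where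

  open RealField ℝ
  open Notation ℝ

  commutativeRing : CommutativeRing 0ℓ 0ℓ
  commutativeRing = record { isCommutativeRing = isCommutativeRing }

  open CommutativeRing commutativeRing public
    using ( _-_; +-assoc; +-comm; +-identityˡ; +-identityʳ; -‿inverseˡ; -‿inverseʳ
          ; *-comm; *-identityˡ; *-identityʳ; zeroˡ; zeroʳ; distribʳ)
  open RingProperties (CommutativeRing.ring commutativeRing) public
    using (-‿involutive; -0#≈0#; -1*x≈-x)
  open AbelianGroupProperties (CommutativeRing.+-abelianGroup commutativeRing)
    using (⁻¹-∙-comm; xyx⁻¹≈y)
  open CommutativeSemigroupProperties (CommutativeRing.*-commutativeSemigroup commutativeRing)
    using (interchange)

  fromℕ-+ : ∀ m n → fromℕ (m ℕ.+ n) ≡ fromℕ m + fromℕ n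
  fromℕ-+ zero    n = sym (+-identityˡ _)
  fromℕ-+ (suc m) n = trans (cong (1# +_) (fromℕ-+ m n)) (sym (+-assoc 1# _ _))

  fromℕ-* : ∀ m n → fromℕ (m ℕ.* n) ≡ fromℕ m * fromℕ n
  fromℕ-* zero    n = sym (zeroˡ _)
  fromℕ-* (suc m) n = begin
    fromℕ (n ℕ.+ m ℕ.* n)             ≡⟨ fromℕ-+ n (m ℕ.* n) ⟩
    fromℕ n + fromℕ (m ℕ.* n)         ≡⟨ cong₂ _+_ (sym (*-identityˡ _)) (fromℕ-* m n) ⟩
    1# * fromℕ n + fromℕ m * fromℕ n  ≡⟨ distribʳ _ 1# _ ⟨
    (1# + fromℕ m) * fromℕ n          ∎
    where open ≡-Reasoning

  fromℤ-⊖ : ∀ m n → fromℤ (m ℤ.⊖ n) ≡ fromℕ m - fromℕ n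
  fromℤ-⊖ zero    zero    = sym (-‿inverseʳ 0#)
  fromℤ-⊖ (suc m) zero    = sym (trans (cong (fromℕ (suc m) +_) -0#≈0#) (+-identityʳ _))
  fromℤ-⊖ zero    (suc n) = sym (+-identityˡ _)
  fromℤ-⊖ (suc m) (suc n) = begin
    fromℤ (suc m ℤ.⊖ suc n)             ≡⟨ cong fromℤ (ℤ.[1+m]⊖[1+n]≡m⊖n m n) ⟩
    fromℤ (m ℤ.⊖ n)                     ≡⟨ fromℤ-⊖ m n ⟩
    fromℕ m - fromℕ n                   ≡⟨ cong (_- fromℕ n) (xyx⁻¹≈y 1# (fromℕ m)) ⟨
    1# + fromℕ m + - 1# - fromℕ n       ≡⟨ +-assoc _ (- 1#) _ ⟩
    1# + fromℕ m + (- 1# + - fromℕ n)   ≡⟨ cong (1# + fromℕ m +_) (⁻¹-∙-comm 1# (fromℕ n)) ⟩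
    fromℕ (suc m) - fromℕ (suc n)       ∎
    where open ≡-Reasoning

  fromℤ-+ : ∀ i j → fromℤ (i ℤ.+ j) ≡ fromℤ i + fromℤ j
  fromℤ-+ (ℤ.+ m)  (ℤ.+ n)  = fromℕ-+ m n
  fromℤ-+ (ℤ.+ m)  -[1+ n ] = fromℤ-⊖ m (suc n)
  fromℤ-+ -[1+ m ] (ℤ.+ n)  = trans (fromℤ-⊖ n (suc m)) (+-comm _ _)
  fromℤ-+ -[1+ m ] -[1+ n ] = begin
    - fromℕ (suc (suc (m ℕ.+ n)))       ≡⟨ cong (-_ ∘ fromℕ ∘ suc) (ℕ.+-suc m n) ⟨
    - fromℕ (suc m ℕ.+ suc n)           ≡⟨ cong -_ (fromℕ-+ (suc m) (suc n)) ⟩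
    - (fromℕ (suc m) + fromℕ (suc n))   ≡⟨ ⁻¹-∙-comm _ _ ⟨
    - fromℕ (suc m) + - fromℕ (suc n)   ∎
    where open ≡-Reasoning

  fromℤ-neg : ∀ i → fromℤ (ℤ.- i) ≡ - fromℤ i
  fromℤ-neg (ℤ.+ zero)  = sym -0#≈0#
  fromℤ-neg (ℤ.+ suc n) = refl
  fromℤ-neg -[1+ n ]    = sym (-‿involutive _)

  signum : Sign → Carrier
  signum Sign.+ = 1#
  signum Sign.- = - 1#

  signum-* : ∀ s t → signum (s Sign.* t) ≡ signum s * signum t
  signum-* Sign.+ t      = sym (*-identityˡ _)
  signum-* Sign.- Sign.+ = sym (*-identityʳ _)
  signum-* Sign.- Sign.- = sym (trans (-1*x≈-x (- 1#)) (-‿involutive 1#))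

  fromℤ-◃ : ∀ s n → fromℤ (s ℤ.◃ n) ≡ signum s * fromℕ n
  fromℤ-◃ s      zero    = sym (zeroʳ _)
  fromℤ-◃ Sign.+ (suc n) = sym (*-identityˡ _)
  fromℤ-◃ Sign.- (suc n) = sym (-1*x≈-x _)

  fromℤ-* : ∀ i j → fromℤ (i ℤ.* j) ≡ fromℤ i * fromℤ j
  fromℤ-* i j = begin
    fromℤ (i ℤ.* j)
      ≡⟨ fromℤ-◃ (ℤ.sign i Sign.* ℤ.sign j) (∣ i ∣ ℕ.* ∣ j ∣) ⟩
    signum (ℤ.sign i Sign.* ℤ.sign j) * fromℕ (∣ i ∣ ℕ.* ∣ j ∣)
      ≡⟨ cong₂ _*_ (signum-* (ℤ.sign i) (ℤ.sign j)) (fromℕ-* ∣ i ∣ ∣ j ∣) ⟩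
    signum (ℤ.sign i) * signum (ℤ.sign j) * (fromℕ ∣ i ∣ * fromℕ ∣ j ∣)
      ≡⟨ interchange _ _ _ _ ⟩
    signum (ℤ.sign i) * fromℕ ∣ i ∣ * (signum (ℤ.sign j) * fromℕ ∣ j ∣)
      ≡⟨ cong₂ _*_ (signed-abs i) (signed-abs j) ⟩
    fromℤ i * fromℤ j
      ∎
    where
    open ≡-Reasoning
    ∣_∣ = ℤ.∣_∣
    signed-abs : ∀ k → signum (ℤ.sign k) * fromℕ ∣ k ∣ ≡ fromℤ k
    signed-abs k = trans (sym (fromℤ-◃ (ℤ.sign k) ∣ k ∣)) (cong fromℤ (ℤ.◃-inverse k))

  -- fromℤ, but sending 1 to 1# on the nose, so that solver constants such as con (ℤ.+ 2) denote
  -- the literal 1# + 1#.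
  literalℕ : ℕ → Carrier
  literalℕ zero          = 0#
  literalℕ (suc zero)    = 1#
  literalℕ (suc (suc n)) = 1# + literalℕ (suc n)

  literal : ℤ → Carrier
  literal (ℤ.+ n)  = literalℕ n
  literal -[1+ n ] = - literalℕ (suc n)

  literalℕ≗fromℕ : ∀ n → literalℕ n ≡ fromℕ n
  literalℕ≗fromℕ zero          = refl
  literalℕ≗fromℕ (suc zero)    = sym (+-identityʳ 1#)
  literalℕ≗fromℕ (suc (suc n)) = cong (1# +_) (literalℕ≗fromℕ (suc n))

  literal≗fromℤ : ∀ i → literal i ≡ fromℤ i
  literal≗fromℤ (ℤ.+ n)  = literalℕ≗fromℕ n
  literal≗fromℤ -[1+ n ] = cong -_ (literalℕ≗fromℕ (suc n))

  literal-homomorphism : ℤ.+-*-rawRing -Raw-AlmostCommutative⟶ fromCommutativeRing commutativeRing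
  literal-homomorphism = record
    { ⟦_⟧    = literal
    ; +-homo = λ i j → via (i ℤ.+ j) (fromℤ-+ i j) (cong₂ _+_ (literal≗fromℤ i) (literal≗fromℤ j))
    ; *-homo = λ i j → via (i ℤ.* j) (fromℤ-* i j) (cong₂ _*_ (literal≗fromℤ i) (literal≗fromℤ j))
    ; -‿homo = λ i → via (ℤ.- i) (fromℤ-neg i) (cong -_ (literal≗fromℤ i))
    ; 0-homo = refl
    ; 1-homo = refl
    }
    where
    via : ∀ k {x y} → fromℤ k ≡ x → y ≡ x → literal k ≡ y
    via k fromℤk≡x y≡x = trans (literal≗fromℤ k) (trans fromℤk≡x (sym y≡x))

  open Algebra.Solver.Ring ℤ.+-*-rawRing (fromCommutativeRing commutativeRing) literal-homomorphism
    (λ i j → map (cong literal) (dec⇒maybe (i ℤ.≟ j))) public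
    using (solve; _:=_; _:+_; _:*_; :-_; con)

  open IsTotalOrder isTotalOrder public
    using () renaming (refl to ≤-refl; trans to ≤-trans; antisym to ≤-antisym; total to ≤-total)

  +-monoʳ-≤ : ∀ {x y} z → x ≤ y → z + x ≤ z + y
  +-monoʳ-≤ {x} {y} z x≤y = subst₂ _≤_ (+-comm x z) (+-comm y z) (+-mono-≤ z x≤y)

  x≤x+y : ∀ {x y} → 0# ≤ y → x ≤ x + y
  x≤x+y {x} {y} 0≤y = subst (_≤ x + y) (+-identityʳ x) (+-monoʳ-≤ x 0≤y)

  +-nonneg : ∀ {x y} → 0# ≤ x → 0# ≤ y → 0# ≤ x + y
  +-nonneg {x} {y} 0≤x 0≤y =
    subst (_≤ x + y) (+-identityˡ 0#) (≤-trans (+-mono-≤ 0# 0≤x) (+-monoʳ-≤ x 0≤y))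

  x+y≡0⇒x≡0 : ∀ {x y} → 0# ≤ x → 0# ≤ y → x + y ≡ 0# → x ≡ 0#
  x+y≡0⇒x≡0 0≤x 0≤y x+y≡0 = ≤-antisym (subst (_ ≤_) x+y≡0 (x≤x+y 0≤y)) 0≤x

  0≤x+x⇒0≤x : ∀ {x} → 0# ≤ x + x → 0# ≤ x
  0≤x+x⇒0≤x {x} 0≤x+x with ≤-total 0# x
  ... | inj₁ 0≤x = 0≤x
  ... | inj₂ x≤0 = ≤-trans 0≤x+x (subst (x + x ≤_) (+-identityˡ x) (+-mono-≤ x x≤0))

  0≤x*x : ∀ x → 0# ≤ x * x
  0≤x*x x with ≤-total 0# x
  ... | inj₁ 0≤x = *-nonneg 0≤x 0≤x
  ... | inj₂ x≤0 = subst (0# ≤_) (solve 1 (λ x → :- x :* :- x := x :* x) refl x) (*-nonneg 0≤-x 0≤-x)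
    where
    0≤-x : 0# ≤ - x
    0≤-x = subst₂ _≤_ (-‿inverseʳ x) (+-identityˡ (- x)) (+-mono-≤ (- x) x≤0)

  0≤1 : 0# ≤ 1#
  0≤1 = subst (0# ≤_) (*-identityˡ 1#) (0≤x*x 1#)

  0≤fromℕ : ∀ n → 0# ≤ fromℕ n
  0≤fromℕ zero    = ≤-refl
  0≤fromℕ (suc n) = +-nonneg 0≤1 (0≤fromℕ n)

  fromℕ-suc≢0 : ∀ n → fromℕ (suc n) ≢ 0#
  fromℕ-suc≢0 n 1+n≡0 = 0≢1 (sym (x+y≡0⇒x≡0 0≤1 (0≤fromℕ n) 1+n≡0))

  x≢0⇒x*x≢0 : ∀ {x} → x ≢ 0# → x * x ≢ 0#
  x≢0⇒x*x≢0 {x} x≢0 x*x≡0 = 0≢1 (begin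
    0#                                ≡⟨ zeroˡ _ ⟨
    0# * (x ⁻¹ * x ⁻¹)                ≡⟨ cong (_* (x ⁻¹ * x ⁻¹)) x*x≡0 ⟨
    x * x * (x ⁻¹ * x ⁻¹)             ≡⟨ interchange x x (x ⁻¹) (x ⁻¹) ⟩
    x * x ⁻¹ * (x * x ⁻¹)             ≡⟨ cong₂ _*_ (⁻¹-inverse x x≢0) (⁻¹-inverse x x≢0) ⟩
    1# * 1#                           ≡⟨ *-identityˡ 1# ⟩
    1#                                ∎)
    where open ≡-Reasoning

module EuclideanSpaceProperties (ℝ : RealField) where

  open RealField ℝ
  open Notation ℝ
  open RealFieldProperties ℝ

  private variable
    d : ℕ

  +ᵥ-assoc : (u v w : V ℝ d) → u +ᵥ v +ᵥ w ≡ u +ᵥ (v +ᵥ w)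
  +ᵥ-assoc = zipWith-assoc +-assoc

  +ᵥ-comm : (u v : V ℝ d) → u +ᵥ v ≡ v +ᵥ u
  +ᵥ-comm = zipWith-comm +-comm

  +ᵥ-identityˡ : (v : V ℝ d) → 0ᵥ +ᵥ v ≡ v
  +ᵥ-identityˡ = zipWith-identityˡ +-identityˡ

  +ᵥ-identityʳ : (v : V ℝ d) → v +ᵥ 0ᵥ ≡ v
  +ᵥ-identityʳ = zipWith-identityʳ +-identityʳ

  +ᵥ-inverseˡ : (v : V ℝ d) → -ᵥ v +ᵥ v ≡ 0ᵥ
  +ᵥ-inverseˡ = zipWith-inverseˡ -‿inverseˡ

  +ᵥ-inverseʳ : (v : V ℝ d) → v +ᵥ -ᵥ v ≡ 0ᵥ
  +ᵥ-inverseʳ = zipWith-inverseʳ -‿inverseʳ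

  +ᵥ-swap : (u v w : V ℝ d) → u +ᵥ (v +ᵥ w) ≡ v +ᵥ (u +ᵥ w)
  +ᵥ-swap u v w = begin
    u +ᵥ (v +ᵥ w)  ≡⟨ +ᵥ-assoc u v w ⟨
    u +ᵥ v +ᵥ w    ≡⟨ cong (_+ᵥ w) (+ᵥ-comm u v) ⟩
    v +ᵥ u +ᵥ w    ≡⟨ +ᵥ-assoc v u w ⟩
    v +ᵥ (u +ᵥ w)  ∎
    where open ≡-Reasoning

  +ᵥ≡0⇒≡-ᵥ : (u v : V ℝ d) → u +ᵥ v ≡ 0ᵥ → v ≡ -ᵥ u
  +ᵥ≡0⇒≡-ᵥ u v u+v≡0 = begin
    v                  ≡⟨ +ᵥ-identityˡ v ⟨
    0ᵥ +ᵥ v            ≡⟨ cong (_+ᵥ v) (+ᵥ-inverseˡ u) ⟨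
    -ᵥ u +ᵥ u +ᵥ v     ≡⟨ +ᵥ-assoc (-ᵥ u) u v ⟩
    -ᵥ u +ᵥ (u +ᵥ v)   ≡⟨ cong (-ᵥ u +ᵥ_) u+v≡0 ⟩
    -ᵥ u +ᵥ 0ᵥ         ≡⟨ +ᵥ-identityʳ (-ᵥ u) ⟩
    -ᵥ u               ∎
    where open ≡-Reasoning

  ·-zeroˡ : (v : V ℝ d) → 0# · v ≡ 0ᵥ
  ·-zeroˡ []      = refl
  ·-zeroˡ (x ∷ v) = cong₂ _∷_ (zeroˡ x) (·-zeroˡ v)

  fromℕ-suc-· : ∀ m (v : V ℝ d) → fromℕ (suc m) · v ≡ v +ᵥ fromℕ m · v
  fromℕ-suc-· m []      = refl
  fromℕ-suc-· m (x ∷ v) =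
    cong₂ _∷_ (trans (distribʳ x 1# (fromℕ m)) (cong (_+ fromℕ m * x) (*-identityˡ x))) (fromℕ-suc-· m v)

  fromℕ-1-· : (v : V ℝ d) → fromℕ 1 · v ≡ v
  fromℕ-1-· v = trans (fromℕ-suc-· 0 v) (trans (cong (v +ᵥ_) (·-zeroˡ v)) (+ᵥ-identityʳ v))

  c·v≡0⇒v≡0 : ∀ {c} → c ≢ 0# → (v : V ℝ d) → c · v ≡ 0ᵥ → v ≡ 0ᵥ
  c·v≡0⇒v≡0 c≢0 []      _       = refl
  c·v≡0⇒v≡0 {c = c} c≢0 (x ∷ v) c·x∷v≡0 =
    cong₂ _∷_ x≡0 (c·v≡0⇒v≡0 c≢0 v (∷-injectiveʳ c·x∷v≡0))
    where
    open ≡-Reasoning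
    x≡0 : x ≡ 0#
    x≡0 = begin
      x                ≡⟨ *-identityˡ x ⟨
      1# * x           ≡⟨ cong (_* x) (⁻¹-inverse c c≢0) ⟨
      c * c ⁻¹ * x     ≡⟨ solve 3 (λ c c⁻¹ x → c :* c⁻¹ :* x := c⁻¹ :* (c :* x)) refl c (c ⁻¹) x ⟩
      c ⁻¹ * (c * x)   ≡⟨ cong (c ⁻¹ *_) (∷-injectiveˡ c·x∷v≡0) ⟩
      c ⁻¹ * 0#        ≡⟨ zeroʳ _ ⟩
      0#               ∎

  ⟨⟩-comm : (u v : V ℝ d) → ⟨ u , v ⟩ ≡ ⟨ v , u ⟩
  ⟨⟩-comm []      []      = refl
  ⟨⟩-comm (x ∷ u) (y ∷ v) = cong₂ _+_ (*-comm x y) (⟨⟩-comm u v)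

  ⟨⟩-zeroʳ : (u : V ℝ d) → ⟨ u , 0ᵥ ⟩ ≡ 0#
  ⟨⟩-zeroʳ []      = refl
  ⟨⟩-zeroʳ (x ∷ u) = trans (cong₂ _+_ (zeroʳ x) (⟨⟩-zeroʳ u)) (+-identityʳ 0#)

  ⟨⟩-distribʳ : (u v w : V ℝ d) → ⟨ u , v +ᵥ w ⟩ ≡ ⟨ u , v ⟩ + ⟨ u , w ⟩
  ⟨⟩-distribʳ []      []      []      = sym (+-identityʳ 0#)
  ⟨⟩-distribʳ (x ∷ u) (y ∷ v) (z ∷ w) = trans (cong (x * (y + z) +_) (⟨⟩-distribʳ u v w))
    (solve 5 (λ x y z p q → x :* (y :+ z) :+ (p :+ q) := x :* y :+ p :+ (x :* z :+ q))
       refl x y z ⟨ u , v ⟩ ⟨ u , w ⟩)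

  ⟨⟩-distribˡ : (u v w : V ℝ d) → ⟨ u +ᵥ v , w ⟩ ≡ ⟨ u , w ⟩ + ⟨ v , w ⟩
  ⟨⟩-distribˡ u v w = begin
    ⟨ u +ᵥ v , w ⟩           ≡⟨ ⟨⟩-comm (u +ᵥ v) w ⟩
    ⟨ w , u +ᵥ v ⟩           ≡⟨ ⟨⟩-distribʳ w u v ⟩
    ⟨ w , u ⟩ + ⟨ w , v ⟩    ≡⟨ cong₂ _+_ (⟨⟩-comm w u) (⟨⟩-comm w v) ⟩
    ⟨ u , w ⟩ + ⟨ v , w ⟩    ∎
    where open ≡-Reasoning

  ⟨⟩-homoˡ-· : ∀ c (u v : V ℝ d) → ⟨ c · u , v ⟩ ≡ c * ⟨ u , v ⟩
  ⟨⟩-homoˡ-· c []      []      = sym (zeroʳ c)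
  ⟨⟩-homoˡ-· c (x ∷ u) (y ∷ v) = trans (cong (c * x * y +_) (⟨⟩-homoˡ-· c u v))
    (solve 4 (λ c x y p → c :* x :* y :+ c :* p := c :* (x :* y :+ p)) refl c x y ⟨ u , v ⟩)

  0≤⟨v,v⟩ : (v : V ℝ d) → 0# ≤ ⟨ v , v ⟩
  0≤⟨v,v⟩ []      = ≤-refl
  0≤⟨v,v⟩ (x ∷ v) = +-nonneg (0≤x*x x) (0≤⟨v,v⟩ v)

  v≢0⇒⟨v,v⟩≢0 : {v : V ℝ d} → v ≢ 0ᵥ → ⟨ v , v ⟩ ≢ 0#
  v≢0⇒⟨v,v⟩≢0 {v = []}    v≢0 _ = v≢0 refl
  v≢0⇒⟨v,v⟩≢0 {v = x ∷ v} x∷v≢0 ⟨x∷v,x∷v⟩≡0 =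
    x≢0⇒x*x≢0 (λ x≡0 → v≢0⇒⟨v,v⟩≢0 (λ v≡0 → x∷v≢0 (cong₂ _∷_ x≡0 v≡0)) ⟨v,v⟩≡0) x*x≡0
    where
    x*x≡0 : x * x ≡ 0#
    x*x≡0 = x+y≡0⇒x≡0 (0≤x*x x) (0≤⟨v,v⟩ v) ⟨x∷v,x∷v⟩≡0
    ⟨v,v⟩≡0 : ⟨ v , v ⟩ ≡ 0#
    ⟨v,v⟩≡0 = x+y≡0⇒x≡0 (0≤⟨v,v⟩ v) (0≤x*x x) (trans (+-comm _ _) ⟨x∷v,x∷v⟩≡0)

  coroot-pairing : {α : V ℝ d} → α ≢ 0ᵥ → ∀ β → ⟨ coroot α , β ⟩ * ⟨ α , α ⟩ ≡ ⟨ α , β ⟩ + ⟨ α , β ⟩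
  coroot-pairing {α = α} α≢0 β = begin
    ⟨ coroot α , β ⟩ * B           ≡⟨ cong (_* B) (⟨⟩-homoˡ-· ((1# + 1#) * B ⁻¹) α β) ⟩
    (1# + 1#) * B ⁻¹ * c * B       ≡⟨ solve 3 (λ B B⁻¹ c → con (ℤ.+ 2) :* B⁻¹ :* c :* B := (c :+ c) :* (B :* B⁻¹))
                                               refl B (B ⁻¹) c ⟩
    (c + c) * (B * B ⁻¹)           ≡⟨ cong ((c + c) *_) (⁻¹-inverse B (v≢0⇒⟨v,v⟩≢0 α≢0)) ⟩
    (c + c) * 1#                   ≡⟨ *-identityʳ _ ⟩
    c + c                          ∎
    where
    open ≡-Reasoning
    B = ⟨ α , α ⟩
    c = ⟨ α , β ⟩

  coroot-pairing-nonneg : ∀ {α β : V ℝ d} {m} → α ≢ 0ᵥ → ⟨ coroot α , β ⟩ ≡ fromℤ (ℤ.+ m) →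
                          0# ≤ ⟨ α , β ⟩
  coroot-pairing-nonneg {α = α} {β} {m} α≢0 pairing≡m = 0≤x+x⇒0≤x
    (subst (0# ≤_) (trans (cong (_* ⟨ α , α ⟩) (sym pairing≡m)) (coroot-pairing α≢0 β))
      (*-nonneg (0≤fromℕ m) (0≤⟨v,v⟩ α)))

  reflect-by-−1 : ∀ {α β : V ℝ d} → ⟨ coroot α , β ⟩ ≡ fromℤ -[1+ 0 ] → reflect α β ≡ α +ᵥ β
  reflect-by-−1 {α = α} {β} pairing≡−1 =
    trans (cong (λ c → β -ᵥ c · α) pairing≡−1) (pointwise α β)
    where
    pointwise : ∀ {d} (α β : V ℝ d) → β -ᵥ fromℤ -[1+ 0 ] · α ≡ α +ᵥ β
    pointwise []      []      = refl
    pointwise (x ∷ α) (y ∷ β) = cong₂ _∷_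
      (solve 2 (λ x y → y :+ :- (:- (con (ℤ.+ 1) :+ con (ℤ.+ 0)) :* x) := x :+ y) refl x y)
      (pointwise α β)

  coroot-pairings≤−2⇒⟨α+β,α+β⟩≡0 :
    ∀ {α β : V ℝ d} {m m′} → α ≢ 0ᵥ → β ≢ 0ᵥ →
    ⟨ coroot α , β ⟩ ≡ fromℤ -[1+ suc m ] → ⟨ coroot β , α ⟩ ≡ fromℤ -[1+ suc m′ ] →
    ⟨ α +ᵥ β , α +ᵥ β ⟩ ≡ 0#
  coroot-pairings≤−2⇒⟨α+β,α+β⟩≡0 {α = α} {β} {m} {m′} α≢0 β≢0 pαβ pβα =
    x+y≡0⇒x≡0 (0≤⟨v,v⟩ (α +ᵥ β)) (+-nonneg (0≤⟨v,v⟩ (α +ᵥ β)) 0≤Y) (begin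
      X + (X + Y)                                                ≡⟨ cong (λ X → X + (X + Y)) expand ⟩
      B + c + (c + G) + (B + c + (c + G) + Y)
        ≡⟨ solve 5 (λ B G c μ μ′ →
             B :+ c :+ (c :+ G) :+ (B :+ c :+ (c :+ G) :+ (μ :* B :+ μ′ :* G))
             := B :+ B :+ μ :* B :+ (c :+ c) :+ (G :+ G :+ μ′ :* G :+ (c :+ c)))
             refl B G c μ μ′ ⟩
      B + B + μ * B + (c + c) + (G + G + μ′ * G + (c + c))
        ≡⟨ cong₂ (λ s t → B + B + μ * B + s + (G + G + μ′ * G + t)) (sym 2c≡αβ) (sym 2c≡βα) ⟩
      B + B + μ * B + fromℤ -[1+ suc m ] * B + (G + G + μ′ * G + fromℤ -[1+ suc m′ ] * G)
        ≡⟨ solve 4 (λ B G μ μ′ →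
             B :+ B :+ μ :* B :+ (:- (con (ℤ.+ 1) :+ (con (ℤ.+ 1) :+ μ))) :* B
               :+ (G :+ G :+ μ′ :* G :+ (:- (con (ℤ.+ 1) :+ (con (ℤ.+ 1) :+ μ′))) :* G)
             := con (ℤ.+ 0))
             refl B G μ μ′ ⟩
      0#                                                         ∎)
    where
    open ≡-Reasoning
    B = ⟨ α , α ⟩
    G = ⟨ β , β ⟩
    c = ⟨ α , β ⟩
    X = ⟨ α +ᵥ β , α +ᵥ β ⟩
    μ = fromℕ m
    μ′ = fromℕ m′
    Y = μ * B + μ′ * G
    0≤Y : 0# ≤ Y
    0≤Y = +-nonneg (*-nonneg (0≤fromℕ m) (0≤⟨v,v⟩ α)) (*-nonneg (0≤fromℕ m′) (0≤⟨v,v⟩ β))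
    expand : X ≡ B + c + (c + G)
    expand = trans (⟨⟩-distribˡ α β (α +ᵥ β))
      (cong₂ _+_ (⟨⟩-distribʳ α α β) (trans (⟨⟩-distribʳ β α β) (cong (_+ G) (⟨⟩-comm β α))))
    2c≡αβ : fromℤ -[1+ suc m ] * B ≡ c + c
    2c≡αβ = trans (cong (_* B) (sym pαβ)) (coroot-pairing α≢0 β)
    2c≡βα : fromℤ -[1+ suc m′ ] * G ≡ c + c
    2c≡βα = trans (cong (_* G) (sym pβα))
      (trans (coroot-pairing β≢0 α) (cong₂ _+_ (⟨⟩-comm β α) (⟨⟩-comm β α)))

  scaled-opposites-cancel : ∀ a b (v : V ℝ d) → b · -ᵥ (a · v) +ᵥ a · -ᵥ (b · -ᵥ v) ≡ 0ᵥ
  scaled-opposites-cancel a b []      = refl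
  scaled-opposites-cancel a b (x ∷ v) = cong₂ _∷_
    (solve 3 (λ a b x → b :* :- (a :* x) :+ a :* :- (b :* :- x) := con (ℤ.+ 0)) refl a b x)
    (scaled-opposites-cancel a b v)

module PositiveSums (ℝ : RealField) {d : ℕ} {E : Set} (r : E → V ℝ d) where

  open RealField ℝ
  open Notation ℝ
  open RealFieldProperties ℝ
  open EuclideanSpaceProperties ℝ

  ∑ : List E → V ℝ d
  ∑ []       = 0ᵥ
  ∑ (x ∷ xs) = r x +ᵥ ∑ xs

  ∑-++ : ∀ xs ys → ∑ (xs ++ ys) ≡ ∑ xs +ᵥ ∑ ys
  ∑-++ []       ys = sym (+ᵥ-identityˡ (∑ ys))
  ∑-++ (x ∷ xs) ys = trans (cong (r x +ᵥ_) (∑-++ xs ys)) (sym (+ᵥ-assoc (r x) (∑ xs) (∑ ys)))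

  ∑-middle : ∀ us y vs → ∑ (us ++ y ∷ vs) ≡ r y +ᵥ ∑ (us ++ vs)
  ∑-middle []       y vs = refl
  ∑-middle (u ∷ us) y vs = trans (cong (r u +ᵥ_) (∑-middle us y vs)) (+ᵥ-swap (r u) (r y) _)

  0≤⟨u,∑⟩ : ∀ u xs → All (λ x → 0# ≤ ⟨ u , r x ⟩) xs → 0# ≤ ⟨ u , ∑ xs ⟩
  0≤⟨u,∑⟩ u []       []           = subst (0# ≤_) (sym (⟨⟩-zeroʳ u)) ≤-refl
  0≤⟨u,∑⟩ u (x ∷ xs) (0≤ux ∷ 0≤u∑) =
    subst (0# ≤_) (sym (⟨⟩-distribʳ u (r x) (∑ xs))) (+-nonneg 0≤ux (0≤⟨u,∑⟩ u xs 0≤u∑))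

  ∑≡0⇒obtuse-member : ∀ {x xs} → Decidable (λ y → 0# ≤ ⟨ r x , r y ⟩) → r x ≢ 0ᵥ →
                      ∑ (x ∷ xs) ≡ 0ᵥ → ∃ λ y → y ∈ₗ xs × ¬ 0# ≤ ⟨ r x , r y ⟩
  ∑≡0⇒obtuse-member {x} {xs} acute? rx≢0 ∑≡0 = find (¬All⇒Any¬ acute? xs ¬all-acute)
    where
    ¬all-acute : ¬ All (λ y → 0# ≤ ⟨ r x , r y ⟩) xs
    ¬all-acute all-acute = v≢0⇒⟨v,v⟩≢0 rx≢0
      (x+y≡0⇒x≡0 (0≤⟨v,v⟩ (r x)) (0≤⟨u,∑⟩ (r x) xs all-acute) (begin
        ⟨ r x , r x ⟩ + ⟨ r x , ∑ xs ⟩  ≡⟨ ⟨⟩-distribʳ (r x) (r x) (∑ xs) ⟨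
        ⟨ r x , ∑ (x ∷ xs) ⟩            ≡⟨ cong (λ v → ⟨ r x , v ⟩) ∑≡0 ⟩
        ⟨ r x , 0ᵥ ⟩                    ≡⟨ ⟨⟩-zeroʳ (r x) ⟩
        0#                              ∎))
      where open ≡-Reasoning

  IsSumOf : V ℝ d → Set
  IsSumOf v = ∃₂ λ x xs → ∑ (x ∷ xs) ≡ v

  IsSumOf-single : ∀ x → IsSumOf (r x)
  IsSumOf-single x = x , [] , +ᵥ-identityʳ (r x)

  IsSumOf-+ : ∀ {u v} → IsSumOf u → IsSumOf v → IsSumOf (u +ᵥ v)
  IsSumOf-+ (x , xs , ∑≡u) (y , ys , ∑≡v) =
    x , xs ++ y ∷ ys , trans (∑-++ (x ∷ xs) (y ∷ ys)) (cong₂ _+ᵥ_ ∑≡u ∑≡v)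

  IsSumOf-· : ∀ {v} → IsSumOf v → ∀ m → IsSumOf (fromℕ (suc m) · v)
  IsSumOf-· {v} sum zero    = subst IsSumOf (sym (fromℕ-1-· v)) sum
  IsSumOf-· {v} sum (suc m) = subst IsSumOf (sym (fromℕ-suc-· (suc m) v)) (IsSumOf-+ sum (IsSumOf-· sum m))

  IsSumOf-combination : ∀ {u v} → IsSumOf u → IsSumOf v → ∀ m l →
                        fromℕ m · u +ᵥ fromℕ l · v ≢ 0ᵥ → IsSumOf (fromℕ m · u +ᵥ fromℕ l · v)
  IsSumOf-combination {u} {v} _ _ zero zero ≢0 =
    ⊥-elim (≢0 (trans (cong₂ _+ᵥ_ (·-zeroˡ u) (·-zeroˡ v)) (+ᵥ-identityˡ 0ᵥ)))
  IsSumOf-combination {u} {v} su _ (suc m) zero _ =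
    subst IsSumOf (trans (sym (+ᵥ-identityʳ _)) (cong (_ +ᵥ_) (sym (·-zeroˡ v)))) (IsSumOf-· su m)
  IsSumOf-combination {u} {v} _ sv zero (suc l) _ =
    subst IsSumOf (trans (sym (+ᵥ-identityˡ _)) (cong (_+ᵥ _) (sym (·-zeroˡ u)))) (IsSumOf-· sv l)
  IsSumOf-combination su sv (suc m) (suc l) _ = IsSumOf-+ (IsSumOf-· su m) (IsSumOf-· sv l)

  IsSumOf-opposites : ∀ {v} → IsSumOf v → IsSumOf (-ᵥ v) → IsSumOf 0ᵥ
  IsSumOf-opposites {v} sv s-v = subst IsSumOf (+ᵥ-inverseʳ v) (IsSumOf-+ sv s-v)

  IsSumOf-opposite-multiples : ∀ {α} κ κ′ →
    IsSumOf (-ᵥ (fromℕ (suc κ) · α)) → IsSumOf (-ᵥ (fromℕ (suc κ′) · -ᵥ α)) → IsSumOf 0ᵥ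
  IsSumOf-opposite-multiples {α} κ κ′ s s′ =
    subst IsSumOf (scaled-opposites-cancel (fromℕ (suc κ)) (fromℕ (suc κ′)) α)
      (IsSumOf-+ (IsSumOf-· s κ′) (IsSumOf-· s′ κ))

module AdjoinedSums (ℝ : RealField) {d : ℕ} {E : Set} (r : E → V ℝ d) (α : V ℝ d) where

  open Notation ℝ
  open RealFieldProperties ℝ
  open EuclideanSpaceProperties ℝ
  open PositiveSums ℝ r
  -- The index nothing stands for the adjoined vector α.
  module ⁺ = PositiveSums ℝ (maybe r α)

  ∑⁺-split : ∀ xs → ∃₂ λ k A → k ℕ.+ length A ≡ length xs × ⁺.∑ xs ≡ fromℕ k · α +ᵥ ∑ A
  ∑⁺-split [] = 0 , [] , refl , sym (trans (cong (_+ᵥ 0ᵥ) (·-zeroˡ α)) (+ᵥ-identityˡ 0ᵥ))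
  ∑⁺-split (just x ∷ xs) with ∑⁺-split xs
  ... | k , A , len , ∑≡ = k , x ∷ A , trans (ℕ.+-suc k (length A)) (cong suc len) ,
                           trans (cong (r x +ᵥ_) ∑≡) (+ᵥ-swap (r x) (fromℕ k · α) (∑ A))
  ∑⁺-split (nothing ∷ xs) with ∑⁺-split xs
  ... | k , A , len , ∑≡ = suc k , A , cong suc len , (begin
    α +ᵥ ⁺.∑ xs                   ≡⟨ cong (α +ᵥ_) ∑≡ ⟩
    α +ᵥ (fromℕ k · α +ᵥ ∑ A)     ≡⟨ +ᵥ-assoc α (fromℕ k · α) (∑ A) ⟨
    α +ᵥ fromℕ k · α +ᵥ ∑ A       ≡⟨ cong (_+ᵥ ∑ A) (fromℕ-suc-· k α) ⟨
    fromℕ (suc k) · α +ᵥ ∑ A      ∎)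
    where open ≡-Reasoning

  zeroSum⁺⇒negative-multiple : ¬ IsSumOf 0ᵥ → α ≢ 0ᵥ → ⁺.IsSumOf 0ᵥ →
                               ∃ λ κ → IsSumOf (-ᵥ (fromℕ (suc κ) · α))
  zeroSum⁺⇒negative-multiple ¬zeroSum α≢0 (x , xs , ∑≡0) with ∑⁺-split (x ∷ xs)
  ... | zero  , []    , ()  , _
  ... | suc κ , []    , _   , ∑≡ = ⊥-elim (α≢0 (c·v≡0⇒v≡0 (fromℕ-suc≢0 κ) α
    (trans (sym (+ᵥ-identityʳ _)) (trans (sym ∑≡) ∑≡0))))
  ... | zero  , y ∷ A , _   , ∑≡ = ⊥-elim (¬zeroSum (y , A ,
    trans (sym (+ᵥ-identityˡ _)) (trans (cong (_+ᵥ ∑ (y ∷ A)) (sym (·-zeroˡ α))) (trans (sym ∑≡) ∑≡0))))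
  ... | suc κ , y ∷ A , _   , ∑≡ = κ , y , A , +ᵥ≡0⇒≡-ᵥ _ _ (trans (sym ∑≡) ∑≡0)

¬¬-decidable : ∀ {n} (P : Fin n → Set) → ¬ ¬ (∀ i → Dec (P i))
¬¬-decidable {zero}  P ¬dec = ¬dec λ ()
¬¬-decidable {suc n} P ¬dec = ¬¬-excluded-middle λ P0? → ¬¬-decidable (P ∘ suc) λ Psuc? →
  ¬dec λ { zero → P0? ; (suc i) → Psuc? i }

module _ {n} {P : Fin n → Set} (P? : ∀ i → Dec (P i)) where

  fromDec : Subset n
  fromDec = tabulate (does ∘ P?)

  ∈-fromDec⁺ : ∀ {i} → P i → i ∈ fromDec
  ∈-fromDec⁺ {i} Pi = lookup⇒[]= i fromDec (trans (lookup∘tabulate (does ∘ P?) i) (dec-true (P? i) Pi))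

  ∈-fromDec⁻ : ∀ {i} → i ∈ fromDec → P i
  ∈-fromDec⁻ {i} i∈ with P? i | trans (sym (lookup∘tabulate (does ∘ P?) i)) ([]=⇒lookup i∈)
  ... | yes Pi | _  = Pi
  ... | no  _  | ()

module RootSystemProperties (ℝ : RealField) {d n : ℕ} (Φ : RootSystem ℝ d n) where

  open RealField ℝ
  open Notation ℝ
  open RealFieldProperties ℝ
  open EuclideanSpaceProperties ℝ
  open RootSystem Φ

  rootIn : (P : Subset n) → Σ (Fin n) (_∈ P) → V ℝ d
  rootIn P = root ∘ proj₁

  module _ (cryst : Crystallographic ℝ Φ) where

    obtuse⇒sum∈Φ : ∀ i j → ¬ 0# ≤ ⟨ root i , root j ⟩ → root j ≢ -ᵥ root i → InΦ (root i +ᵥ root j)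
    obtuse⇒sum∈Φ i j obtuse j≢-i with cryst i j | cryst j i
    ... | ℤ.+ m , pij | _ = ⊥-elim (obtuse (coroot-pairing-nonneg {m = m} (nonzero i) pij))
    ... | -[1+ zero ] , pij | _ = subst InΦ (reflect-by-−1 pij) (reflect⊆ i j)
    ... | -[1+ suc _ ] , _ | ℤ.+ m , pji = ⊥-elim (obtuse
      (subst (0# ≤_) (⟨⟩-comm (root j) (root i)) (coroot-pairing-nonneg {m = m} (nonzero j) pji)))
    ... | -[1+ suc _ ] , _ | -[1+ zero ] , pji =
      subst InΦ (trans (reflect-by-−1 pji) (+ᵥ-comm (root j) (root i))) (reflect⊆ j i)
    ... | -[1+ suc m ] , pij | -[1+ suc m′ ] , pji =
      ⊥-elim (v≢0⇒⟨v,v⟩≢0 (j≢-i ∘ +ᵥ≡0⇒≡-ᵥ (root i) (root j))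
        (coroot-pairings≤−2⇒⟨α+β,α+β⟩≡0 {m = m} {m′} (nonzero i) (nonzero j) pij pji))

    ΦPoset⇒¬zeroSum : ∀ {P} → IsΦPoset ℝ Φ P → ¬ PositiveSums.IsSumOf ℝ (rootIn P) 0ᵥ
    ΦPoset⇒¬zeroSum {P} (antisym , closed) (x , xs , ∑≡0) = ¬zeroSum (length xs) x xs refl ∑≡0
      where
      open PositiveSums ℝ (rootIn P)

      -- Some summand pairs negatively with the first, and the two merge into one root of P.
      ¬zeroSum : ∀ N x xs → length xs ≡ N → ∑ (x ∷ xs) ≢ 0ᵥ
      ¬zeroSum zero    x []      _   ∑≡0 = nonzero (proj₁ x) (trans (sym (+ᵥ-identityʳ _)) ∑≡0)
      ¬zeroSum zero    x (_ ∷ _) ()  _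
      ¬zeroSum (suc N) x xs      len ∑≡0 = ¬¬-decidable (λ j → 0# ≤ ⟨ rootIn P x , root j ⟩) λ acute? →
        merge (∑≡0⇒obtuse-member {x} {xs} (acute? ∘ proj₁) (nonzero (proj₁ x)) ∑≡0)
        where
        merge : ∃ (λ y → y ∈ₗ xs × ¬ 0# ≤ ⟨ rootIn P x , rootIn P y ⟩) → ⊥
        merge (y@(j , j∈P) , y∈xs , obtuse) with ∈-∃++ y∈xs
        ... | us , vs , refl with obtuse⇒sum∈Φ (proj₁ x) j obtuse (antisym (proj₁ x) j (proj₂ x) j∈P)
        ...   | k , k≡x+y = ¬zeroSum N (k , k∈P) (us ++ vs) shorter (begin
          root k +ᵥ ∑ (us ++ vs)                    ≡⟨ cong (_+ᵥ ∑ (us ++ vs)) k≡x+y ⟩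
          rootIn P x +ᵥ root j +ᵥ ∑ (us ++ vs)      ≡⟨ +ᵥ-assoc (rootIn P x) (root j) (∑ (us ++ vs)) ⟩
          rootIn P x +ᵥ (root j +ᵥ ∑ (us ++ vs))    ≡⟨ cong (rootIn P x +ᵥ_) (∑-middle us y vs) ⟨
          ∑ (x ∷ us ++ y ∷ vs)                      ≡⟨ ∑≡0 ⟩
          0ᵥ                                        ∎)
          where
          open ≡-Reasoning
          k∈P : k ∈ P
          k∈P = closed (proj₁ x) j k 1 1 (proj₂ x) j∈P
            (trans (cong₂ _+ᵥ_ (fromℕ-1-· (rootIn P x)) (fromℕ-1-· (root j))) (sym k≡x+y))
          shorter : length (us ++ vs) ≡ N
          shorter = ℕ.suc-injective (begin
            suc (length (us ++ vs))            ≡⟨ cong suc (length-++ us) ⟩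
            suc (length us ℕ.+ length vs)      ≡⟨ ℕ.+-suc (length us) (length vs) ⟨
            length us ℕ.+ length (y ∷ vs)      ≡⟨ length-++ us ⟨
            length (us ++ y ∷ vs)              ≡⟨ len ⟩
            suc N                              ∎)

  module _ (R : Subset n) (a : Fin n) where

    open PositiveSums ℝ (maybe (rootIn R) (root a))

    generated-closed : (generated? : ∀ i → Dec (IsSumOf (root i))) → Closed ℝ Φ (fromDec generated?)
    generated-closed generated? i j k m l i∈ j∈ combination≡k = ∈-fromDec⁺ generated?
      (subst IsSumOf combination≡k
        (IsSumOf-combination (∈-fromDec⁻ generated? i∈) (∈-fromDec⁻ generated? j∈) m l
          (nonzero k ∘ trans (sym combination≡k))))

    generated-antisymmetric : (generated? : ∀ i → Dec (IsSumOf (root i))) → ¬ IsSumOf 0ᵥ →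
                              Antisymmetric ℝ Φ (fromDec generated?)
    generated-antisymmetric generated? ¬zeroSum i j i∈ j∈ j≡-i = ¬zeroSum
      (IsSumOf-opposites (∈-fromDec⁻ generated? i∈) (subst IsSumOf j≡-i (∈-fromDec⁻ generated? j∈)))

    -- Membership in the generated set is not decidable, so it is a Subset only under ¬ ¬.
    maximal⇒¬¬zeroSum⁺ : (∀ S → Ext ℝ Φ R S → S ≡ R) → a ∉ R → ¬ ¬ IsSumOf 0ᵥ
    maximal⇒¬¬zeroSum⁺ maximal a∉R ¬zeroSum = ¬¬-decidable (IsSumOf ∘ root) λ generated? →
      let T = fromDec generated?
          R⊆T : R ⊆ T
          R⊆T j∈R = ∈-fromDec⁺ generated? (IsSumOf-single (just (_ , j∈R)))
          T-extends-R : Ext ℝ Φ R T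
          T-extends-R = (generated-antisymmetric generated? ¬zeroSum , generated-closed generated?) , R⊆T
      in a∉R (subst (a ∈_) (maximal T T-extends-R) (∈-fromDec⁺ generated? (IsSumOf-single nothing)))

  module _ (cryst : Crystallographic ℝ Φ) {R : Subset n} (R-poset : IsΦPoset ℝ Φ R) where

    open PositiveSums ℝ (rootIn R)
    module Adjoin (α : V ℝ d) = AdjoinedSums ℝ (rootIn R) α

    R-¬zeroSum : ¬ IsSumOf 0ᵥ
    R-¬zeroSum = ΦPoset⇒¬zeroSum cryst R-poset

    opposite-roots-not-both-adjoinable :
      ∀ {i k} → root k ≡ -ᵥ root i →
      PositiveSums.IsSumOf ℝ (maybe (rootIn R) (root i)) 0ᵥ →
      PositiveSums.IsSumOf ℝ (maybe (rootIn R) (root k)) 0ᵥ → ⊥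
    opposite-roots-not-both-adjoinable {i} {k} k≡-i zeroSum⁺ᵢ zeroSum⁺ₖ =
      let κ  , sumᵢ = Adjoin.zeroSum⁺⇒negative-multiple (root i) R-¬zeroSum (nonzero i) zeroSum⁺ᵢ
          κ′ , sumₖ = Adjoin.zeroSum⁺⇒negative-multiple (root k) R-¬zeroSum (nonzero k) zeroSum⁺ₖ
      in R-¬zeroSum (IsSumOf-opposite-multiples κ κ′ sumᵢ
           (subst (λ β → IsSumOf (-ᵥ (fromℕ (suc κ′) · β))) k≡-i sumₖ))

    maximal⇒covers : (∀ S → Ext ℝ Φ R S → S ≡ R) →
                     ∀ i → (i ∈ R) ⊎ (∃[ j ] (j ∈ R × root j ≡ -ᵥ root i))
    maximal⇒covers maximal i with i ∈? R
    ... | yes i∈R = inj₁ i∈R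
    ... | no  i∉R with proj₁ (line⊇ i (-ᵥ root i) (inj₂ refl))
    ...   | k , k≡-i with k ∈? R
    ...     | yes k∈R = inj₂ (k , k∈R , k≡-i)
    ...     | no  k∉R = ⊥-elim
      (maximal⇒¬¬zeroSum⁺ R i maximal i∉R λ zeroSum⁺ᵢ →
       maximal⇒¬¬zeroSum⁺ R k maximal k∉R λ zeroSum⁺ₖ →
       opposite-roots-not-both-adjoinable k≡-i zeroSum⁺ᵢ zeroSum⁺ₖ)

  covers⇒maximal : ∀ {R} → (∀ i → (i ∈ R) ⊎ (∃[ j ] (j ∈ R × root j ≡ -ᵥ root i))) →
                   ∀ S → Ext ℝ Φ R S → S ≡ R
  covers⇒maximal {R} covers S ((S-antisym , _) , R⊆S) = ⊆-antisym S⊆R R⊆S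
    where
    S⊆R : S ⊆ R
    S⊆R {i} i∈S with covers i
    ... | inj₁ i∈R             = i∈R
    ... | inj₂ (j , j∈R , j≡-i) = ⊥-elim (S-antisym i j i∈S (R⊆S j∈R) j≡-i)

open Defs using (-ᵥ_)

proposition2p18 : (ℝ : RealField) {d n : ℕ} (Φ : RootSystem ℝ d n) →
    Crystallographic ℝ Φ → (R : Subset n) → IsΦPoset ℝ Φ R →
    ((∀ S → Ext ℝ Φ R S → S ≡ R) ⇔
     (∀ i → (i ∈ R) ⊎ (∃[ j ] (j ∈ R × RootSystem.root Φ j ≡ -ᵥ_ ℝ (RootSystem.root Φ i)))))
proposition2p18 ℝ Φ cryst R R-poset = mk⇔ (maximal⇒covers cryst R-poset) covers⇒maximal
  where open RootSystemProperties ℝ Φ
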